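{- For all integers $n\ge1$, $m\ge1$ and $\ell$, \[W(\ell,n,m)=(n-1)\,W(\ell,n-1,m)+\sum_{j=0}^{n-1}\binom{n-1}{j}\,j!\,W(\ell-j,n-1-j,m-1).\]
   Context: A partition of $\{1,\dots,n\}$ into $m$ linearly ordered blocks is a set partition into $m$ nonempty blocks, each equipped with a linear order (a sequence). For a block $b$, its weight $w(b)$ is the number of elements of $b$ that are smaller (as integers) than the first element of $b$; the weight of the partition $\pi$ is $w(\pi)=\sum_{b\in\pi}w(b)$. The weighted Lah number $W(\ell,n,m)$ is the number of partitions of $\{1,\dots,n\}$ into exactly $m$ linearly ordered blocks with weight $\ell$. Conventions: $W(\ell,n,m)=0$ if $\ell<0$ or $m<0$, and for $n=0$ the empty set has exactly one partition, with $0$ blocks and weight $0$, so $W(0,0,0)=1$ and $W(\ell,0,m)=0$ otherwise. -}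

module Defs where

open import Data.Nat using (ℕ; zero; suc; _+_; _*_; _≤_; _<_; _<?_; _≟_; _⊓_)
open import Data.Nat.Properties using (≤-<-connex) renaming (_≤?_ to _≤?ℕ_)
open import Data.Integer using (ℤ; +_; -[1+_])
open import Data.List using (List; []; _∷_; length; map; concat; concatMap; filter; upTo; foldr)
open import Data.Nat.ListAction using (sum)
open import Data.List.Relation.Unary.All using (All; all?)
open import Data.List.Relation.Unary.Linked using (Linked; linked?)
open import Data.List.Relation.Unary.Unique.Propositional using (Unique)
open import Data.List.Relation.Unary.Unique.DecPropositional _≟_ using (unique?)
open import Data.List.Membership.Propositional using (_∈_)
open import Data.List.Membership.DecPropositional _≟_ using (_∈?_)
open import Data.Product using (_×_)
open import Relation.Nullary using (Dec)
open import Relation.Nullary.Decidable using (_×-dec_)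
open import Relation.Binary.PropositionalEquality using (_≡_)

oneTo : ℕ → List ℕ
oneTo n = map suc (upTo n)

-- A linearly ordered block is a list (sequence) of elements.
-- Weight of a block: number of its elements smaller than its first element.
blockWeight : List ℕ → ℕ
blockWeight []       = 0
blockWeight (x ∷ xs) = length (filter (_<? x) xs)

weight : List (List ℕ) → ℕ
weight bs = sum (map blockWeight bs)

-- Minimum element of a block (used only to list the unordered blocks
-- of a set partition in a canonical order: increasing minima).
blockMin : List ℕ → ℕ
blockMin []       = 0
blockMin (x ∷ xs) = foldr _⊓_ x xs

-- bs represents a partition of {1,…,n} into exactly m linearly ordered blocks:
-- exactly m blocks, each nonempty, the blocks are pairwise disjoint and
-- duplicate free (concatenation has no repetitions), every element lies in
-- {1,…,n}, every element of {1,…,n} occurs; blocks listed by increasing minimum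
-- (canonical representative of the unordered set of blocks).
IsLOPartition : ℕ → ℕ → List (List ℕ) → Set
IsLOPartition n m bs =
  (length bs ≡ m) ×
  (All (λ b → 0 < length b) bs ×
  (Unique (concat bs) ×
  (All (λ x → (1 ≤ x) × (x ≤ n)) (concat bs) ×
  (All (λ x → x ∈ concat bs) (oneTo n) ×
  Linked (λ b c → blockMin b < blockMin c) bs))))

isLOPartition? : ∀ n m bs → Dec (IsLOPartition n m bs)
isLOPartition? n m bs =
  (length bs ≟ m) ×-dec
  (all? (λ b → 0 <? length b) bs ×-dec
  (unique? (concat bs) ×-dec
  (all? (λ x → (1 ≤?ℕ x) ×-dec (x ≤?ℕ n)) (concat bs) ×-dec
  (all? (λ x → x ∈? concat bs) (oneTo n) ×-dec
  linked? (λ b c → blockMin b <? blockMin c) bs))))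

words : ℕ → {A : Set} → List A → List (List A)
words zero    xs = [] ∷ []
words (suc k) xs = concatMap (λ x → map (x ∷_) (words k xs)) xs

-- Finite superset of all candidate partitions: lists of m blocks, each block
-- a list of length ≤ n over {1,…,n}.
candidates : ℕ → ℕ → List (List (List ℕ))
candidates n m = words m (concatMap (λ k → words k (oneTo n)) (upTo (suc n)))

Wℕ : ℕ → ℕ → ℕ → ℕ
Wℕ k n m = length (filter (λ bs → isLOPartition? n m bs ×-dec (weight bs ≟ k)) (candidates n m))

W : ℤ → ℕ → ℕ → ℕ
W (+ k)    n m = Wℕ k n m
W -[1+ _ ] n m = 0

module Submission where

-- Order the ground set decreasingly and look at its largest element x. If x does not lead its
-- block, deleting it leaves a partition of the other n − 1 elements with the same number of
-- blocks and the same weight, into which x can be put back right after any of them. If x leads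
-- its block x w, that block has weight j = |w|, the word w is one of the C(n−1,j) j! arrangements
-- of j smaller elements, and the other m − 1 blocks partition the remaining n − 1 − j elements
-- with weight ℓ − j. Since weights only compare elements, the number of partitions of any
-- (n − 1 − j)-element set is that of {1,…,n − 1 − j}. All counts are lengths of duplicate-free
-- lists enumerating exactly the partitions in question.

open import Defs
open import Data.Nat using (ℕ; zero; suc; _+_; _*_; _∸_; _≤_; _<_; _>_; _!; z≤n; s≤s; _<?_; _≟_; _⊓_; _≤?_)
open import Data.Nat.Properties
open import Data.Nat.Combinatorics using (_C_; nCk+nC[k+1]≡[n+1]C[k+1])
open import Data.Nat.Solver using (module +-*-Solver)
open import Data.Nat.ListAction using (sum)
open import Data.Nat.ListAction.Properties using (sum-↭)
open import Data.Integer using (ℤ; +_; -[1+_]; _-_; -_)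
open import Data.Integer.Properties using (m-n≡m⊖n; ⊖-≥; ⊖-<)
open import Data.List using (List; []; _∷_; _++_; [_]; map; upTo; length; concat; concatMap; filter; foldr; cartesianProductWith)
open import Data.List.Properties using (length-map; length-++; length-filter; filter-all; filter-reject; filter-notAll; map-cong-local; ∷-injective; ∷-injectiveˡ; ∷-injectiveʳ; ≡-dec)
open import Data.List.Relation.Unary.All as All using (All; []; _∷_)
import Data.List.Relation.Unary.All.Properties as AllP
open import Data.List.Relation.Unary.Any as Any using (Any; here; there)
open import Data.List.Relation.Unary.AllPairs as AllPairs using (AllPairs; []; _∷_)
import Data.List.Relation.Unary.AllPairs.Properties as AllPairsP
import Data.List.Relation.Unary.Linked.Properties as LinkedP
open import Data.List.Relation.Unary.Unique.Propositional using (Unique)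
import Data.List.Relation.Unary.Unique.Propositional.Properties as UniqueP
open import Data.List.Membership.Propositional using (_∈_; _∉_; find; lose)
open import Data.List.Membership.Propositional.Properties
open import Data.List.Membership.DecPropositional _≟_ using (_∈?_)
open import Data.List.Relation.Binary.Subset.Propositional using (_⊆_)
open import Data.List.Relation.Binary.Subset.Propositional.Properties using (⊆-trans; ⊆-respˡ-↭; ⊆-respʳ-↭; ∷⁺ʳ; xs⊆x∷xs; ⊆∷∧∉⇒⊆)
open import Data.List.Relation.Binary.Disjoint.Propositional using (Disjoint)
open import Data.List.Relation.Binary.Permutation.Propositional as Perm using (_↭_; ↭-sym; ↭-trans; ↭-refl; ↭-prep; ↭-swap; ↭⇒↭ₛ)
import Data.List.Relation.Binary.Permutation.Propositional.Properties as PermP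
import Data.List.Relation.Binary.Permutation.Setoid.Properties as PermSetoidP
open import Data.Product as Product using (Σ; _×_; _,_; proj₁; proj₂)
open import Data.Sum using (inj₁; inj₂)
open import Data.Empty using (⊥-elim)
open import Function using (_∘_)
open import Relation.Nullary using (Dec; yes; no; ¬_; ¬?)
open import Relation.Nullary.Decidable using (_×-dec_)
open import Relation.Unary using (Decidable)
open import Relation.Binary.Definitions using (DecidableEquality)
open import Relation.Binary.PropositionalEquality hiding ([_])
import Algebra.Properties.CommutativeSemigroup ⊓-commutativeSemigroup as ⊓-CS

-- Counting with duplicate-free lists

Unique-resp-↭ : {A : Set} {xs ys : List A} → xs ↭ ys → Unique xs → Unique ys
Unique-resp-↭ {A} p = PermSetoidP.Unique-resp-↭ (setoid A) (↭⇒↭ₛ p)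

Unique-++⁻ : {A : Set} (xs : List A) {ys : List A} → Unique (xs ++ ys) →
  Unique xs × Unique ys × Disjoint xs ys
Unique-++⁻ []       u         = [] , u , λ { (() , _) }
Unique-++⁻ (x ∷ xs) (x∉ ∷ u) with Unique-++⁻ xs u
... | uxs , uys , disjoint = All.tabulate (All.lookup x∉ ∘ ∈-++⁺ˡ) ∷ uxs , uys , disjoint′
  where
  disjoint′ : Disjoint (x ∷ xs) _
  disjoint′ (here refl , q) = All.lookup x∉ (∈-++⁺ʳ xs q) refl
  disjoint′ (there p , q)   = disjoint (p , q)

Unique-concat⁻ : {A : Set} (xss : List (List A)) → Unique (concat xss) → All Unique xss
Unique-concat⁻ []         _ = []
Unique-concat⁻ (xs ∷ xss) u =
  proj₁ (Unique-++⁻ xs u) ∷ Unique-concat⁻ xss (proj₁ (proj₂ (Unique-++⁻ xs u)))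

module _ {A : Set} (_≟_ : DecidableEquality A) where

  length-mono-⊆ : {xs ys : List A} → Unique xs → xs ⊆ ys → length xs ≤ length ys
  length-mono-⊆ {[]}     _         _   = z≤n
  length-mono-⊆ {x ∷ xs} {ys} (x∉ ∷ u) xs⊆ys = begin
    suc (length xs)                  ≤⟨ s≤s (length-mono-⊆ u xs⊆ys∖x) ⟩
    suc (length (filter (x ≢?_) ys)) ≤⟨ filter-notAll (x ≢?_) ys (Any.map (λ e ne → ne e) (xs⊆ys (here refl))) ⟩
    length ys                        ∎
    where
    open ≤-Reasoning
    _≢?_ : (a b : A) → Dec (a ≢ b)
    a ≢? b = ¬? (a ≟ b)
    xs⊆ys∖x : xs ⊆ filter (x ≢?_) ys
    xs⊆ys∖x z∈ = ∈-filter⁺ (x ≢?_) (xs⊆ys (there z∈)) (All.lookup x∉ z∈)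

  length-≡-⊆⊇ : {xs ys : List A} → Unique xs → Unique ys → xs ⊆ ys → ys ⊆ xs → length xs ≡ length ys
  length-≡-⊆⊇ uxs uys xs⊆ys ys⊆xs = ≤-antisym (length-mono-⊆ uxs xs⊆ys) (length-mono-⊆ uys ys⊆xs)

Unique-concatMap⁺ : {A B : Set} (f : A → List B) (tag : B → A) {xs : List A} → Unique xs →
  (∀ {a} → a ∈ xs → Unique (f a)) → (∀ {a b} → a ∈ xs → b ∈ f a → tag b ≡ a) →
  Unique (concatMap f xs)
Unique-concatMap⁺ f tag {[]}     _        _  _   = []
Unique-concatMap⁺ f tag {a ∷ xs} (a∉ ∷ u) uf tagged =
  UniqueP.++⁺ (uf (here refl)) (Unique-concatMap⁺ f tag u (uf ∘ there) (tagged ∘ there)) disjoint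
  where
  disjoint : Disjoint (f a) (concatMap f xs)
  disjoint (b∈fa , b∈rest) with find (∈-concatMap⁻ f {xs = xs} b∈rest)
  ... | a′ , a′∈ , b∈fa′ = All.lookup a∉ a′∈ (trans (sym (tagged (here refl) b∈fa)) (tagged (there a′∈) b∈fa′))

Unique-map⁺-retract : {A B : Set} (f : A → B) (g : B → A) {xs : List A} → Unique xs →
  (∀ {a} → a ∈ xs → g (f a) ≡ a) → Unique (map f xs)
Unique-map⁺-retract f g {[]}     _        _   = []
Unique-map⁺-retract f g {a ∷ xs} (a∉ ∷ u) inv =
  AllP.map⁺ (All.tabulate λ c∈ e → All.lookup a∉ c∈ (trans (sym (inv (here refl))) (trans (cong g e) (inv (there c∈)))))
  ∷ Unique-map⁺-retract f g u (inv ∘ there)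

Enumerates : {A : Set} → List A → (A → Set) → Set
Enumerates xs P = Unique xs × (∀ {a} → a ∈ xs → P a) × (∀ {a} → P a → a ∈ xs)

Enumerates-++ : {A : Set} {P Q : A → Set} {xs ys : List A} → Decidable Q →
  Enumerates xs (λ a → P a × ¬ Q a) → Enumerates ys (λ a → P a × Q a) → Enumerates (xs ++ ys) P
Enumerates-++ {xs = xs} Q? (u-xs , xs⁻ , xs⁺) (u-ys , ys⁻ , ys⁺) =
  UniqueP.++⁺ u-xs u-ys (λ (p , q) → proj₂ (xs⁻ p) (proj₂ (ys⁻ q))) , sound , complete
  where
  sound : ∀ {a} → a ∈ xs ++ _ → _
  sound q with ∈-++⁻ xs q
  ... | inj₁ q′ = proj₁ (xs⁻ q′)
  ... | inj₂ q′ = proj₁ (ys⁻ q′)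
  complete : ∀ {a} → _ → a ∈ xs ++ _
  complete {a} pa with Q? a
  ... | yes qa = ∈-++⁺ʳ xs (ys⁺ (pa , qa))
  ... | no ¬qa = ∈-++⁺ˡ (xs⁺ (pa , ¬qa))

length-Enumerates : {A : Set} → DecidableEquality A → {P : A → Set} {xs ys : List A} →
  Enumerates xs P → Enumerates ys P → length xs ≡ length ys
length-Enumerates _≟_ (u-xs , xs⁻ , xs⁺) (u-ys , ys⁻ , ys⁺) =
  length-≡-⊆⊇ _≟_ u-xs u-ys (ys⁺ ∘ xs⁻) (xs⁺ ∘ ys⁻)

length-concatMap : {A B : Set} (f : A → List B) (xs : List A) →
  length (concatMap f xs) ≡ sum (map (length ∘ f) xs)
length-concatMap f []       = refl
length-concatMap f (x ∷ xs) = trans (length-++ (f x)) (cong (λ n → length (f x) + n) (length-concatMap f xs))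

length-filter-∁ : {A : Set} {P : A → Set} (P? : Decidable P) (xs : List A) →
  length (filter P? xs) + length (filter (¬? ∘ P?) xs) ≡ length xs
length-filter-∁ P? []       = refl
length-filter-∁ P? (x ∷ xs) with P? x
... | yes _ = cong suc (length-filter-∁ P? xs)
... | no  _ = trans (+-suc _ _) (cong suc (length-filter-∁ P? xs))

sum-map-cong : {A : Set} {f g : A → ℕ} (xs : List A) → (∀ {x} → x ∈ xs → f x ≡ g x) →
  sum (map f xs) ≡ sum (map g xs)
sum-map-cong xs eq = cong sum (map-cong-local (All.tabulate eq))

sum-map-const : {A : Set} (f : A → ℕ) {c : ℕ} (xs : List A) → (∀ {x} → x ∈ xs → f x ≡ c) →
  sum (map f xs) ≡ length xs * c
sum-map-const f []       _  = refl
sum-map-const f (x ∷ xs) eq = cong₂ _+_ (eq (here refl)) (sum-map-const f xs (eq ∘ there))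

-- Arrangements

insertions : {A : Set} → A → List A → List (List A)
insertions y []       = [ [ y ] ]
insertions y (z ∷ zs) = (y ∷ z ∷ zs) ∷ map (z ∷_) (insertions y zs)

module _ {A : Set} {y : A} where

  length-insertions : (w : List A) → length (insertions y w) ≡ suc (length w)
  length-insertions []       = refl
  length-insertions (z ∷ zs) = cong suc (trans (length-map (z ∷_) (insertions y zs)) (length-insertions zs))

  ∈-insertions⇒↭ : {w v : List A} → v ∈ insertions y w → v ↭ y ∷ w
  ∈-insertions⇒↭ {[]}     (here refl) = ↭-refl
  ∈-insertions⇒↭ {z ∷ zs} (here refl) = ↭-refl
  ∈-insertions⇒↭ {z ∷ zs} (there p) with ∈-map⁻ (z ∷_) p
  ... | v , v∈ , refl = ↭-trans (↭-prep z (∈-insertions⇒↭ v∈)) (↭-swap z y ↭-refl)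

  Unique-insertions : (w : List A) → y ∉ w → Unique (insertions y w)
  Unique-insertions []       _  = [] ∷ []
  Unique-insertions (z ∷ zs) y∉ =
    All.tabulate headDiffers ∷ UniqueP.map⁺ ∷-injectiveʳ (Unique-insertions zs (y∉ ∘ there))
    where
    headDiffers : ∀ {v} → v ∈ map (z ∷_) (insertions y zs) → (y ∷ z ∷ zs) ≢ v
    headDiffers p e with ∈-map⁻ (z ∷_) p
    ... | _ , _ , refl = y∉ (here (∷-injectiveˡ e))

module Arrangements {A : Set} (_≟_ : DecidableEquality A) where

  remove : A → List A → List A
  remove y []       = []
  remove y (z ∷ zs) with y ≟ z
  ... | yes _ = remove y zs
  ... | no  _ = z ∷ remove y zs

  remove-∉ : ∀ {y} w → y ∉ w → remove y w ≡ w
  remove-∉ []       _  = refl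
  remove-∉ {y} (z ∷ zs) y∉ with y ≟ z
  ... | yes y≡z = ⊥-elim (y∉ (here y≡z))
  ... | no  _   = cong (z ∷_) (remove-∉ zs (y∉ ∘ there))

  remove-∷ : ∀ {y z} w → y ≢ z → remove y (z ∷ w) ≡ z ∷ remove y w
  remove-∷ {y} {z} w y≢z with y ≟ z
  ... | yes y≡z = ⊥-elim (y≢z y≡z)
  ... | no  _   = refl

  remove-head : ∀ y w → remove y (y ∷ w) ≡ remove y w
  remove-head y w with y ≟ y
  ... | yes _   = refl
  ... | no  y≢y = ⊥-elim (y≢y refl)

  remove-insertions : ∀ {y} w {v} → y ∉ w → v ∈ insertions y w → remove y v ≡ w
  remove-insertions {y} []       y∉ (here refl) = remove-head y []
  remove-insertions {y} (z ∷ zs) y∉ (here refl) = trans (remove-head y (z ∷ zs)) (remove-∉ (z ∷ zs) y∉)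
  remove-insertions {y} (z ∷ zs) y∉ (there p) with ∈-map⁻ (z ∷_) p
  ... | v , v∈ , refl =
    trans (remove-∷ v (y∉ ∘ here)) (cong (z ∷_) (remove-insertions zs (y∉ ∘ there) v∈))

  ∈-insertions-remove : ∀ {y} v → y ∈ v → Unique v → v ∈ insertions y (remove y v)
  ∈-insertions-remove {y} (z ∷ zs) y∈ (z∉ ∷ u) with y ≟ z
  ∈-insertions-remove {y} (z ∷ zs) y∈        (z∉ ∷ u) | yes refl
    rewrite remove-∉ zs (λ q → All.lookup z∉ q refl) with zs
  ... | []    = here refl
  ... | _ ∷ _ = here refl
  ∈-insertions-remove {y} (z ∷ zs) (here y≡z) (z∉ ∷ u) | no y≢z = ⊥-elim (y≢z y≡z)
  ∈-insertions-remove {y} (z ∷ zs) (there y∈) (z∉ ∷ u) | no _   =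
    there (∈-map⁺ (z ∷_) (∈-insertions-remove zs y∈ u))

  ∈-remove⁻ : ∀ {y z} v → z ∈ remove y v → z ∈ v × y ≢ z
  ∈-remove⁻ {y} (w ∷ ws) p with y ≟ w
  ... | yes _ = let z∈ , y≢z = ∈-remove⁻ ws p in there z∈ , y≢z
  ∈-remove⁻ {y} (w ∷ ws) (here refl) | no y≢w = here refl , y≢w
  ∈-remove⁻ {y} (w ∷ ws) (there p)   | no _   = let z∈ , y≢z = ∈-remove⁻ ws p in there z∈ , y≢z

  arrangements : ℕ → List A → List (List A)
  arrangements zero    ys       = [ [] ]
  arrangements (suc j) []       = []
  arrangements (suc j) (y ∷ ys) = arrangements (suc j) ys ++ concatMap (insertions y) (arrangements j ys)

  IsArrangement : ℕ → List A → List A → Set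
  IsArrangement j ys w = length w ≡ j × Unique w × w ⊆ ys

  ∈-arrangements⁻ : ∀ j ys {w} → Unique ys → w ∈ arrangements j ys → IsArrangement j ys w
  ∈-arrangements⁻ zero    ys       _        (here refl) = refl , [] , λ ()
  ∈-arrangements⁻ (suc j) (y ∷ ys) {w} (y∉ ∷ u) p with ∈-++⁻ (arrangements (suc j) ys) p
  ... | inj₁ q = let len , uw , w⊆ = ∈-arrangements⁻ (suc j) ys u q in len , uw , there ∘ w⊆
  ... | inj₂ q with find (∈-concatMap⁻ (insertions y) {xs = arrangements j ys} q)
  ...   | v , v∈ , w∈ =
    trans (PermP.↭-length w↭) (cong suc len) ,
    Unique-resp-↭ (↭-sym w↭) (All.tabulate (λ z∈ → All.lookup y∉ (v⊆ z∈)) ∷ uv) ,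
    λ z∈ → y∷v⊆ (PermP.∈-resp-↭ w↭ z∈)
    where
    len = proj₁ (∈-arrangements⁻ j ys u v∈)
    uv  = proj₁ (proj₂ (∈-arrangements⁻ j ys u v∈))
    v⊆  = proj₂ (proj₂ (∈-arrangements⁻ j ys u v∈))
    w↭ = ∈-insertions⇒↭ w∈
    y∷v⊆ : y ∷ v ⊆ y ∷ ys
    y∷v⊆ (here e)  = here e
    y∷v⊆ (there r) = there (v⊆ r)

  ∈-arrangements⁺ : ∀ j ys {w} → Unique ys → IsArrangement j ys w → w ∈ arrangements j ys
  ∈-arrangements⁺ zero    ys       {[]}    _ _ = here refl
  ∈-arrangements⁺ (suc j) []       {z ∷ _} _ (_ , _ , w⊆) with w⊆ (here refl)
  ... | ()
  ∈-arrangements⁺ (suc j) (y ∷ ys) {w} (y∉ ∷ u) (len , uw , w⊆) with Any.any? (y ≟_) w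
  ... | no y∉w = ∈-++⁺ˡ (∈-arrangements⁺ (suc j) ys u (len , uw , w⊆ys))
    where
    w⊆ys : w ⊆ ys
    w⊆ys r with w⊆ r
    ... | here refl = ⊥-elim (y∉w r)
    ... | there r′  = r′
  ... | yes y∈w = ∈-++⁺ʳ (arrangements (suc j) ys)
      (∈-concatMap⁺ (insertions y) {xs = arrangements j ys}
        (lose (∈-arrangements⁺ j ys u (len′ , AllPairs.tail (Unique-resp-↭ w↭ uw) , w∖y⊆ys)) w∈))
    where
    w∈ : w ∈ insertions y (remove y w)
    w∈ = ∈-insertions-remove w y∈w uw
    w↭ : w ↭ y ∷ remove y w
    w↭ = ∈-insertions⇒↭ w∈
    len′ : length (remove y w) ≡ j
    len′ = suc-injective (trans (sym (PermP.↭-length w↭)) len)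
    w∖y⊆ys : remove y w ⊆ ys
    w∖y⊆ys r with ∈-remove⁻ w r
    ... | r′ , y≢z with w⊆ r′
    ... | here e   = ⊥-elim (y≢z (sym e))
    ... | there r″ = r″

  Unique-arrangements : ∀ j ys → Unique ys → Unique (arrangements j ys)
  Unique-arrangements zero    ys       _        = [] ∷ []
  Unique-arrangements (suc j) []       _        = []
  Unique-arrangements (suc j) (y ∷ ys) (y∉ ∷ u) =
    UniqueP.++⁺ (Unique-arrangements (suc j) ys u)
      (Unique-concatMap⁺ (insertions y) (remove y) (Unique-arrangements j ys u)
        (λ {v} v∈ → Unique-insertions v (y∉v j v∈))
        (λ {v} v∈ w∈ → remove-insertions v (y∉v j v∈) w∈))
      disjoint
    where
    y∉v : ∀ i {v} → v ∈ arrangements i ys → y ∉ v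
    y∉v i v∈ r = All.lookup y∉ (proj₂ (proj₂ (∈-arrangements⁻ i ys u v∈)) r) refl
    disjoint : Disjoint (arrangements (suc j) ys) (concatMap (insertions y) (arrangements j ys))
    disjoint (p , q) with find (∈-concatMap⁻ (insertions y) {xs = arrangements j ys} q)
    ... | v , v∈ , w∈ =
      y∉v (suc j) p (PermP.∈-resp-↭ (↭-sym (∈-insertions⇒↭ w∈)) (here refl))

  length-arrangements : ∀ j ys → Unique ys → length (arrangements j ys) ≡ (length ys C j) * j !
  length-arrangements zero    ys       _        = refl
  length-arrangements (suc j) []       _        = refl
  length-arrangements (suc j) (y ∷ ys) (y∉ ∷ u) = begin
    length (arrangements (suc j) ys ++ concatMap (insertions y) (arrangements j ys))
      ≡⟨ length-++ (arrangements (suc j) ys) ⟩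
    length (arrangements (suc j) ys) + length (concatMap (insertions y) (arrangements j ys))
      ≡⟨ cong (λ t → length (arrangements (suc j) ys) + t) (trans (length-concatMap (insertions y) (arrangements j ys))
           (sum-map-const (length ∘ insertions y) (arrangements j ys)
              (λ {v} v∈ → trans (length-insertions v) (cong suc (proj₁ (∈-arrangements⁻ j ys u v∈)))))) ⟩
    length (arrangements (suc j) ys) + length (arrangements j ys) * suc j
      ≡⟨ cong₂ (λ a b → a + b * suc j) (length-arrangements (suc j) ys u) (length-arrangements j ys u) ⟩
    (n C suc j) * (suc j * j !) + (n C j) * j ! * suc j
      ≡⟨ solve 4 (λ a b s f → b :* (s :* f) :+ a :* f :* s := (a :+ b) :* (s :* f)) refl (n C j) (n C suc j) (suc j) (j !) ⟩
    (n C j + n C suc j) * (suc j * j !)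
      ≡⟨ cong (_* (suc j * j !)) (nCk+nC[k+1]≡[n+1]C[k+1] n j) ⟩
    (suc n C suc j) * (suc j * j !) ∎
    where
    open ≡-Reasoning
    open +-*-Solver
    n = length ys

open Arrangements _≟_

-- Blocks

Blocks : Set
Blocks = List (List ℕ)

foldr-⊓-↭ : ∀ y {v v′} → v ↭ v′ → foldr _⊓_ y v ≡ foldr _⊓_ y v′
foldr-⊓-↭ y Perm.refl         = refl
foldr-⊓-↭ y (Perm.prep x p)   = cong (x ⊓_) (foldr-⊓-↭ y p)
foldr-⊓-↭ y (Perm.swap a b p) =
  trans (cong (λ t → a ⊓ (b ⊓ t)) (foldr-⊓-↭ y p)) (⊓-CS.x∙yz≈y∙xz a b _)
foldr-⊓-↭ y (Perm.trans p q)  = trans (foldr-⊓-↭ y p) (foldr-⊓-↭ y q)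

foldr-⊓-≤ : ∀ y v → foldr _⊓_ y v ≤ y
foldr-⊓-≤ y []      = ≤-refl
foldr-⊓-≤ y (z ∷ v) = ≤-trans (m⊓n≤n z _) (foldr-⊓-≤ y v)

foldr-⊓-∈ : ∀ y v → foldr _⊓_ y v ∈ y ∷ v
foldr-⊓-∈ y []      = here refl
foldr-⊓-∈ y (z ∷ v) with ⊓-sel z (foldr _⊓_ y v)
... | inj₁ e rewrite e = there (here refl)
... | inj₂ e rewrite e with foldr-⊓-∈ y v
...   | here e′ = here e′
...   | there p = there (there p)

blockMin-∈ : ∀ b → 0 < length b → blockMin b ∈ b
blockMin-∈ (y ∷ v) _ = foldr-⊓-∈ y v

blockMin-insertions : ∀ {x y ys v} → y < x → v ∈ insertions x ys → blockMin (y ∷ v) ≡ blockMin (y ∷ ys)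
blockMin-insertions {ys = ys} y<x p =
  trans (foldr-⊓-↭ _ (∈-insertions⇒↭ p)) (m≥n⇒m⊓n≡n (≤-trans (foldr-⊓-≤ _ ys) (<⇒≤ y<x)))

blockWeight-insertions : ∀ {x y ys v} → y < x → v ∈ insertions x ys → blockWeight (y ∷ v) ≡ blockWeight (y ∷ ys)
blockWeight-insertions {y = y} y<x p =
  trans (PermP.↭-length (PermP.filter-↭ (_<? y) (∈-insertions⇒↭ p)))
        (cong length (filter-reject (_<? y) (λ x<y → <-asym x<y y<x)))

blockWeight-led : ∀ {x} w → All (_< x) w → blockWeight (x ∷ w) ≡ length w
blockWeight-led {x} w w<x = cong length (filter-all (_<? x) w<x)

data LedBy (x : ℕ) : List ℕ → Set where
  led : ∀ w → LedBy x (x ∷ w)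

ledBy? : ∀ x b → Dec (LedBy x b)
ledBy? x []      = no λ ()
ledBy? x (y ∷ w) with x ≟ y
... | yes refl = yes (led w)
... | no  x≢y  = no λ { (led _) → x≢y refl }

leader-∈ : ∀ {x} bs → Any (LedBy x) bs → x ∈ concat bs
leader-∈ (.(_ ∷ w) ∷ bs) (here (led w)) = here refl
leader-∈ (b ∷ bs)        (there l)      = ∈-++⁺ʳ b (leader-∈ bs l)

insertIntoBlocks : ℕ → Blocks → List Blocks
insertIntoBlocks x []             = []
insertIntoBlocks x ([] ∷ bs)      = map ([] ∷_) (insertIntoBlocks x bs)
insertIntoBlocks x ((y ∷ ys) ∷ bs) =
  map (λ v → (y ∷ v) ∷ bs) (insertions x ys) ++ map ((y ∷ ys) ∷_) (insertIntoBlocks x bs)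

data InsertedInto (x : ℕ) : Blocks → Blocks → Set where
  here  : ∀ {y ys v bs} → v ∈ insertions x ys → InsertedInto x ((y ∷ ys) ∷ bs) ((y ∷ v) ∷ bs)
  there : ∀ {b bs bs′} → InsertedInto x bs bs′ → InsertedInto x (b ∷ bs) (b ∷ bs′)

module _ {x : ℕ} where

  ∈-insertIntoBlocks⁻ : ∀ bs {bs′} → bs′ ∈ insertIntoBlocks x bs → InsertedInto x bs bs′
  ∈-insertIntoBlocks⁻ ([] ∷ bs) p with ∈-map⁻ ([] ∷_) p
  ... | bs″ , bs″∈ , refl = there (∈-insertIntoBlocks⁻ bs bs″∈)
  ∈-insertIntoBlocks⁻ ((y ∷ ys) ∷ bs) p with ∈-++⁻ (map (λ v → (y ∷ v) ∷ bs) (insertions x ys)) p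
  ... | inj₁ q with ∈-map⁻ (λ v → (y ∷ v) ∷ bs) q
  ...   | v , v∈ , refl = here v∈
  ∈-insertIntoBlocks⁻ ((y ∷ ys) ∷ bs) p | inj₂ q with ∈-map⁻ ((y ∷ ys) ∷_) q
  ...   | bs″ , bs″∈ , refl = there (∈-insertIntoBlocks⁻ bs bs″∈)

  InsertedInto-length : ∀ {bs bs′} → InsertedInto x bs bs′ → length bs′ ≡ length bs
  InsertedInto-length (here _)  = refl
  InsertedInto-length (there i) = cong suc (InsertedInto-length i)

  InsertedInto-concat : ∀ {bs bs′} → InsertedInto x bs bs′ → concat bs′ ↭ x ∷ concat bs
  InsertedInto-concat {(y ∷ ys) ∷ bs} (here v∈) =
    ↭-trans (↭-prep y (PermP.++⁺ʳ (concat bs) (∈-insertions⇒↭ v∈))) (↭-swap y x ↭-refl)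
  InsertedInto-concat {b ∷ bs} (there i) =
    ↭-trans (PermP.++⁺ˡ b (InsertedInto-concat i)) (PermP.shift x b (concat bs))

  InsertedInto-nonEmpty : ∀ {bs bs′} → All (λ b → 0 < length b) bs → InsertedInto x bs bs′ →
    All (λ b → 0 < length b) bs′
  InsertedInto-nonEmpty (_ ∷ ne) (here _)  = s≤s z≤n ∷ ne
  InsertedInto-nonEmpty (n ∷ ne) (there i) = n ∷ InsertedInto-nonEmpty ne i

  InsertedInto-blockMin : ∀ {bs bs′} → All (_< x) (concat bs) → InsertedInto x bs bs′ →
    map blockMin bs′ ≡ map blockMin bs
  InsertedInto-blockMin (y<x ∷ _) (here v∈) = cong (_∷ _) (blockMin-insertions y<x v∈)
  InsertedInto-blockMin {b ∷ _} <x (there i) = cong (blockMin b ∷_) (InsertedInto-blockMin (AllP.++⁻ʳ b <x) i)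

  InsertedInto-weight : ∀ {bs bs′} → All (_< x) (concat bs) → InsertedInto x bs bs′ → weight bs′ ≡ weight bs
  InsertedInto-weight (y<x ∷ _) (here v∈) = cong (_+ _) (blockWeight-insertions y<x v∈)
  InsertedInto-weight {b ∷ _} <x (there i) = cong (λ t → blockWeight b + t) (InsertedInto-weight (AllP.++⁻ʳ b <x) i)

  map-remove-∉ : ∀ bs → x ∉ concat bs → map (remove x) bs ≡ bs
  map-remove-∉ []       _  = refl
  map-remove-∉ (b ∷ bs) x∉ = cong₂ _∷_ (remove-∉ b (x∉ ∘ ∈-++⁺ˡ)) (map-remove-∉ bs (x∉ ∘ ∈-++⁺ʳ b))

  InsertedInto-remove : ∀ {bs bs′} → x ∉ concat bs → InsertedInto x bs bs′ → map (remove x) bs′ ≡ bs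
  InsertedInto-remove {(y ∷ ys) ∷ bs} x∉ (here {v = v} v∈) =
    cong₂ _∷_ (trans (remove-∷ v (x∉ ∘ here)) (cong (y ∷_) (remove-insertions ys (x∉ ∘ there ∘ ∈-++⁺ˡ) v∈)))
              (map-remove-∉ bs (x∉ ∘ there ∘ ∈-++⁺ʳ ys))
  InsertedInto-remove {b ∷ bs} x∉ (there i) =
    cong₂ _∷_ (remove-∉ b (x∉ ∘ ∈-++⁺ˡ)) (InsertedInto-remove (x∉ ∘ ∈-++⁺ʳ b) i)

  InsertedInto-notLed : ∀ {bs bs′} → x ∉ concat bs → InsertedInto x bs bs′ → ¬ Any (LedBy x) bs′
  InsertedInto-notLed x∉ (here v∈) (here (led _)) = x∉ (here refl)
  InsertedInto-notLed {(y ∷ ys) ∷ bs} x∉ (here v∈) (there l) = x∉ (there (∈-++⁺ʳ ys (leader-∈ bs l)))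
  InsertedInto-notLed x∉ (there i) (here (led _)) = x∉ (here refl)
  InsertedInto-notLed {b ∷ bs} x∉ (there i) (there l) = InsertedInto-notLed (x∉ ∘ ∈-++⁺ʳ b) i l

  ∈-insertIntoBlocks⁺ : ∀ bs′ → x ∈ concat bs′ → Unique (concat bs′) → ¬ Any (LedBy x) bs′ →
    bs′ ∈ insertIntoBlocks x (map (remove x) bs′)
  ∈-insertIntoBlocks⁺ ([] ∷ bs′) x∈ u notLed =
    ∈-map⁺ ([] ∷_) (∈-insertIntoBlocks⁺ bs′ x∈ u (notLed ∘ there))
  ∈-insertIntoBlocks⁺ ((y ∷ v) ∷ bs′) x∈ u notLed with x ≟ y | Unique-++⁻ (y ∷ v) u
  ... | yes refl | _ = ⊥-elim (notLed (here (led v)))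
  ... | no x≢y   | u-yv , u-rest , disjoint with ∈-++⁻ (y ∷ v) x∈
  ...   | inj₁ (here x≡y) = ⊥-elim (x≢y x≡y)
  ...   | inj₁ (there x∈v) rewrite map-remove-∉ bs′ (λ q → disjoint (there x∈v , q)) =
    ∈-++⁺ˡ (∈-map⁺ (λ w → (y ∷ w) ∷ bs′) (∈-insertions-remove v x∈v (AllPairs.tail u-yv)))
  ...   | inj₂ x∈rest rewrite remove-∉ v (λ q → disjoint (there q , x∈rest)) =
    ∈-++⁺ʳ (map (λ w → (y ∷ w) ∷ map (remove x) bs′) (insertions x v))
      (∈-map⁺ ((y ∷ v) ∷_) (∈-insertIntoBlocks⁺ bs′ x∈rest u-rest (notLed ∘ there)))

  Unique-insertIntoBlocks : ∀ bs → x ∉ concat bs → Unique (insertIntoBlocks x bs)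
  Unique-insertIntoBlocks []              _  = []
  Unique-insertIntoBlocks ([] ∷ bs)       x∉ = UniqueP.map⁺ ∷-injectiveʳ (Unique-insertIntoBlocks bs x∉)
  Unique-insertIntoBlocks ((y ∷ ys) ∷ bs) x∉ =
    UniqueP.++⁺ (UniqueP.map⁺ (∷-injectiveʳ ∘ ∷-injectiveˡ) (Unique-insertions ys (x∉ ∘ there ∘ ∈-++⁺ˡ)))
                (UniqueP.map⁺ ∷-injectiveʳ (Unique-insertIntoBlocks bs (x∉ ∘ ∈-++⁺ʳ (y ∷ ys))))
                disjoint
    where
    disjoint : Disjoint (map (λ v → (y ∷ v) ∷ bs) (insertions x ys)) (map ((y ∷ ys) ∷_) (insertIntoBlocks x bs))
    disjoint (p , q) with ∈-map⁻ (λ v → (y ∷ v) ∷ bs) p | ∈-map⁻ ((y ∷ ys) ∷_) q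
    ... | v , v∈ , refl | _ , _ , e =
      x∉ (there (∈-++⁺ˡ (subst (x ∈_) (∷-injectiveʳ (∷-injectiveˡ e))
        (PermP.∈-resp-↭ (↭-sym (∈-insertions⇒↭ v∈)) (here refl)))))

  length-insertIntoBlocks : ∀ bs → length (insertIntoBlocks x bs) ≡ length (concat bs)
  length-insertIntoBlocks []              = refl
  length-insertIntoBlocks ([] ∷ bs)       =
    trans (length-map ([] ∷_) (insertIntoBlocks x bs)) (length-insertIntoBlocks bs)
  length-insertIntoBlocks ((y ∷ ys) ∷ bs) = begin
    length (map (λ v → (y ∷ v) ∷ bs) (insertions x ys) ++ map ((y ∷ ys) ∷_) (insertIntoBlocks x bs))
      ≡⟨ length-++ (map (λ v → (y ∷ v) ∷ bs) (insertions x ys)) ⟩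
    length (map (λ v → (y ∷ v) ∷ bs) (insertions x ys)) + length (map ((y ∷ ys) ∷_) (insertIntoBlocks x bs))
      ≡⟨ cong₂ _+_ (trans (length-map _ (insertions x ys)) (length-insertions ys))
                   (trans (length-map _ (insertIntoBlocks x bs)) (length-insertIntoBlocks bs)) ⟩
    suc (length ys) + length (concat bs)
      ≡⟨ cong suc (length-++ ys) ⟨
    length (concat ((y ∷ ys) ∷ bs)) ∎
    where open ≡-Reasoning

_≺_ : List ℕ → List ℕ → Set
b ≺ c = blockMin b < blockMin c

insertByMin : List ℕ → Blocks → Blocks
insertByMin b []       = [ b ]
insertByMin b (c ∷ cs) with blockMin b <? blockMin c
... | yes _ = b ∷ c ∷ cs
... | no  _ = c ∷ insertByMin b cs

insertByMin-↭ : ∀ b cs → insertByMin b cs ↭ b ∷ cs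
insertByMin-↭ b []       = ↭-refl
insertByMin-↭ b (c ∷ cs) with blockMin b <? blockMin c
... | yes _ = ↭-refl
... | no  _ = ↭-trans (↭-prep c (insertByMin-↭ b cs)) (↭-swap c b ↭-refl)

weight-insertByMin : ∀ b cs → weight (insertByMin b cs) ≡ blockWeight b + weight cs
weight-insertByMin b cs = sum-↭ (PermP.map⁺ blockWeight (insertByMin-↭ b cs))

concat-↭ : {xss yss : Blocks} → xss ↭ yss → concat xss ↭ concat yss
concat-↭ Perm.refl         = ↭-refl
concat-↭ (Perm.prep x p)   = PermP.++⁺ˡ x (concat-↭ p)
concat-↭ (Perm.swap x y p) = ↭-trans (PermP.++⁺ˡ x (PermP.++⁺ˡ y (concat-↭ p))) (PermP.shifts x y)
concat-↭ (Perm.trans p q)  = ↭-trans (concat-↭ p) (concat-↭ q)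

insertByMin-sorted : ∀ b cs → AllPairs _≺_ cs → All (λ c → blockMin b ≢ blockMin c) cs →
  AllPairs _≺_ (insertByMin b cs)
insertByMin-sorted b []       _           _          = [] ∷ []
insertByMin-sorted b (c ∷ cs) (c≺ ∷ sorted) (b≢c ∷ ≢s) with blockMin b <? blockMin c
... | yes b≺c = (b≺c ∷ All.map (<-trans b≺c) c≺) ∷ c≺ ∷ sorted
... | no  b⊀c = PermP.All-resp-↭ (↭-sym (insertByMin-↭ b cs)) (c≺b ∷ c≺) ∷ insertByMin-sorted b cs sorted ≢s
  where
  c≺b : c ≺ b
  c≺b = ≤∧≢⇒< (≮⇒≥ b⊀c) (b≢c ∘ sym)

blockLedBy : ℕ → Blocks → List ℕ
blockLedBy x []       = []
blockLedBy x (b ∷ bs) with ledBy? x b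
... | yes _ = b
... | no  _ = blockLedBy x bs

deleteBlockLedBy : ℕ → Blocks → Blocks
deleteBlockLedBy x []       = []
deleteBlockLedBy x (b ∷ bs) with ledBy? x b
... | yes _ = bs
... | no  _ = b ∷ deleteBlockLedBy x bs

module _ (x : ℕ) (w : List ℕ) where

  blockLedBy-insertByMin : ∀ cs → ¬ Any (LedBy x) cs → blockLedBy x (insertByMin (x ∷ w) cs) ≡ x ∷ w
  blockLedBy-insertByMin [] _ with ledBy? x (x ∷ w)
  ... | yes _  = refl
  ... | no ¬l  = ⊥-elim (¬l (led w))
  blockLedBy-insertByMin (c ∷ cs) notLed with blockMin (x ∷ w) <? blockMin c
  ... | yes _ with ledBy? x (x ∷ w)
  ...   | yes _ = refl
  ...   | no ¬l = ⊥-elim (¬l (led w))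
  blockLedBy-insertByMin (c ∷ cs) notLed | no _ with ledBy? x c
  ...   | yes l = ⊥-elim (notLed (here l))
  ...   | no  _ = blockLedBy-insertByMin cs (notLed ∘ there)

  deleteBlockLedBy-insertByMin : ∀ cs → ¬ Any (LedBy x) cs → deleteBlockLedBy x (insertByMin (x ∷ w) cs) ≡ cs
  deleteBlockLedBy-insertByMin [] _ with ledBy? x (x ∷ w)
  ... | yes _ = refl
  ... | no ¬l = ⊥-elim (¬l (led w))
  deleteBlockLedBy-insertByMin (c ∷ cs) notLed with blockMin (x ∷ w) <? blockMin c
  ... | yes _ with ledBy? x (x ∷ w)
  ...   | yes _ = refl
  ...   | no ¬l = ⊥-elim (¬l (led w))
  deleteBlockLedBy-insertByMin (c ∷ cs) notLed | no _ with ledBy? x c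
  ...   | yes l = ⊥-elim (notLed (here l))
  ...   | no  _ = cong (c ∷_) (deleteBlockLedBy-insertByMin cs (notLed ∘ there))

module _ (x : ℕ) where

  blockLedBy-∈ : ∀ bs → Any (LedBy x) bs → blockLedBy x bs ∈ bs
  blockLedBy-∈ (c ∷ cs) l with ledBy? x c
  ... | yes _ = here refl
  blockLedBy-∈ (c ∷ cs) (here l)  | no ¬l = ⊥-elim (¬l l)
  blockLedBy-∈ (c ∷ cs) (there l) | no _  = there (blockLedBy-∈ cs l)

  blockLedBy-led : ∀ bs → Any (LedBy x) bs → Σ (List ℕ) λ w → blockLedBy x bs ≡ x ∷ w
  blockLedBy-led (c ∷ cs) l with ledBy? x c
  ... | yes (led w) = w , refl
  blockLedBy-led (c ∷ cs) (here l)  | no ¬l = ⊥-elim (¬l l)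
  blockLedBy-led (c ∷ cs) (there l) | no _  = blockLedBy-led cs l

  insertByMin-blockLedBy : ∀ bs → AllPairs _≺_ bs → Any (LedBy x) bs →
    insertByMin (blockLedBy x bs) (deleteBlockLedBy x bs) ≡ bs
  insertByMin-blockLedBy (c ∷ cs) (c≺ ∷ sorted) l with ledBy? x c
  insertByMin-blockLedBy (c ∷ [])     (c≺ ∷ sorted) l | yes _ = refl
  insertByMin-blockLedBy (c ∷ d ∷ ds) (c≺ ∷ sorted) l | yes _ with blockMin c <? blockMin d
  ... | yes _   = refl
  ... | no  c⊀d = ⊥-elim (c⊀d (All.head c≺))
  insertByMin-blockLedBy (c ∷ cs) (c≺ ∷ sorted) (here l)  | no ¬l = ⊥-elim (¬l l)
  insertByMin-blockLedBy (c ∷ cs) (c≺ ∷ sorted) (there l) | no _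
    with blockMin (blockLedBy x cs) <? blockMin c
  ... | yes ≺c = ⊥-elim (<-asym ≺c (All.lookup c≺ (blockLedBy-∈ cs l)))
  ... | no  _  = cong (c ∷_) (insertByMin-blockLedBy cs sorted l)

  deleteBlockLedBy-notLed : ∀ bs → Unique (concat bs) → ¬ Any (LedBy x) (deleteBlockLedBy x bs)
  deleteBlockLedBy-notLed (c ∷ cs) u with ledBy? x c
  ... | yes (led w) = λ l → proj₂ (proj₂ (Unique-++⁻ (x ∷ w) u)) (here refl , leader-∈ cs l)
  ... | no  ¬l      = λ { (here l) → ¬l l ; (there l) → deleteBlockLedBy-notLed cs (proj₁ (proj₂ (Unique-++⁻ c u))) l }

  All-deleteBlockLedBy : {P : List ℕ → Set} → ∀ bs → All P bs → All P (deleteBlockLedBy x bs)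
  All-deleteBlockLedBy []       _        = []
  All-deleteBlockLedBy (c ∷ cs) (p ∷ ps) with ledBy? x c
  ... | yes _ = ps
  ... | no  _ = p ∷ All-deleteBlockLedBy cs ps

  deleteBlockLedBy-sorted : ∀ bs → AllPairs _≺_ bs → AllPairs _≺_ (deleteBlockLedBy x bs)
  deleteBlockLedBy-sorted []       _             = []
  deleteBlockLedBy-sorted (c ∷ cs) (c≺ ∷ sorted) with ledBy? x c
  ... | yes _ = sorted
  ... | no  _ = All-deleteBlockLedBy cs c≺ ∷ deleteBlockLedBy-sorted cs sorted

-- Partitions of a descending list

Descending : List ℕ → Set
Descending = AllPairs _>_

Descending⇒Unique : ∀ {T} → Descending T → Unique T
Descending⇒Unique = AllPairs.map (λ b<a a≡b → <-irrefl (sym a≡b) b<a)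

record IsPartition (T : List ℕ) (m k : ℕ) (bs : Blocks) : Set where
  constructor isPartition
  field
    length≡  : length bs ≡ m
    nonEmpty : All (λ b → 0 < length b) bs
    unique   : Unique (concat bs)
    ⊆T       : concat bs ⊆ T
    ⊇T       : T ⊆ concat bs
    sorted   : AllPairs _≺_ bs
    weight≡  : weight bs ≡ k

∉? : (w : List ℕ) → Decidable (_∉ w)
∉? w z = ¬? (z ∈? w)

_∖_ : List ℕ → List ℕ → List ℕ
ts ∖ w = filter (∉? w) ts

module _ {ts w R : List ℕ} where

  ++-⊆-∖ : w ⊆ ts → R ⊆ ts ∖ w → w ++ R ⊆ ts
  ++-⊆-∖ w⊆ts R⊆ q with ∈-++⁻ w q
  ... | inj₁ q′ = w⊆ts q′
  ... | inj₂ q′ = proj₁ (∈-filter⁻ (∉? w) {xs = ts} (R⊆ q′))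

  ⊆-++-∖ : ts ∖ w ⊆ R → ts ⊆ w ++ R
  ⊆-++-∖ ⊇R {z} q with z ∈? w
  ... | yes z∈w = ∈-++⁺ˡ z∈w
  ... | no  z∉w = ∈-++⁺ʳ w (⊇R (∈-filter⁺ (∉? w) q z∉w))

  ⊆-∖ : R ⊆ ts → Disjoint w R → R ⊆ ts ∖ w
  ⊆-∖ R⊆ts w#R q = ∈-filter⁺ (∉? w) (R⊆ts q) (λ z∈w → w#R (z∈w , q))

  ∖-⊆ : ts ⊆ w ++ R → ts ∖ w ⊆ R
  ∖-⊆ ts⊆ q with ∈-filter⁻ (∉? w) {xs = ts} q
  ... | z∈ts , z∉w with ∈-++⁻ w (ts⊆ z∈ts)
  ...   | inj₁ z∈w = ⊥-elim (z∉w z∈w)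
  ...   | inj₂ z∈R = z∈R

-- The block x ∷ w has weight j = length w, whence the weight k ∸ j left for the other blocks.
ledPartitionsOfSize : (List ℕ → ℕ → ℕ → List Blocks) → ℕ → List ℕ → ℕ → ℕ → ℕ → List Blocks
ledPartitionsOfSize rec x ts m k j with j ≤? k
... | yes _ = concatMap (λ w → map (insertByMin (x ∷ w)) (rec (ts ∖ w) m (k ∸ j))) (arrangements j ts)
... | no  _ = []

ledPartitions : (List ℕ → ℕ → ℕ → List Blocks) → ℕ → List ℕ → ℕ → ℕ → List Blocks
ledPartitions rec x ts zero    k = []
ledPartitions rec x ts (suc m) k = concatMap (ledPartitionsOfSize rec x ts m k) (upTo (suc (length ts)))

-- The first argument is fuel, at least the length of the ground list. That list is kept in
-- decreasing order, so its head x either sits inside a block away from the head (no weight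
-- change) or leads a block.
partitions : ℕ → List ℕ → ℕ → ℕ → List Blocks
partitions f       []       zero    zero    = [ [] ]
partitions f       []       zero    (suc k) = []
partitions f       []       (suc m) k       = []
partitions zero    (x ∷ ts) m       k       = []
partitions (suc f) (x ∷ ts) m       k       =
  concatMap (insertIntoBlocks x) (partitions f ts m k) ++ ledPartitions (partitions f) x ts m k

IsPartition-[] : ∀ {m k bs} → IsPartition [] m k bs → bs ≡ [] × m ≡ 0 × k ≡ 0
IsPartition-[] {bs = []}          P = refl , sym (IsPartition.length≡ P) , sym (IsPartition.weight≡ P)
IsPartition-[] {bs = [] ∷ _}      P with IsPartition.nonEmpty P
... | () ∷ _
IsPartition-[] {bs = (_ ∷ _) ∷ _} P with IsPartition.⊆T P (here refl)
... | ()

partitions-[] : ∀ f m k → Enumerates (partitions f [] m k) (IsPartition [] m k)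
partitions-[] f zero    zero    =
  [] ∷ [] , (λ { (here refl) → isPartition refl [] [] (λ ()) (λ ()) [] refl }) ,
  λ P → here (proj₁ (IsPartition-[] P))
partitions-[] f zero    (suc k) = [] , (λ ()) , λ P → ⊥-elim (1+n≢0 (proj₂ (proj₂ (IsPartition-[] P))))
partitions-[] f (suc m) k       = [] , (λ ()) , λ P → ⊥-elim (1+n≢0 (proj₁ (proj₂ (IsPartition-[] P))))

module _ {x : ℕ} {ts : List ℕ} (desc : Descending (x ∷ ts)) where

  private
    ts<x : All (_< x) ts
    ts<x = AllPairs.head desc

    x∉ts : x ∉ ts
    x∉ts q = <-irrefl refl (All.lookup ts<x q)

    u-ts : Unique ts
    u-ts = Descending⇒Unique (AllPairs.tail desc)

  InsertedInto-IsPartition : ∀ {m k bs bs′} → IsPartition ts m k bs → InsertedInto x bs bs′ →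
    IsPartition (x ∷ ts) m k bs′
  InsertedInto-IsPartition {m} {k} {bs} {bs′} (isPartition len ne u ⊆ts ⊇ts sorted w) i =
    isPartition (trans (InsertedInto-length i) len) (InsertedInto-nonEmpty ne i)
      (Unique-resp-↭ (↭-sym bs′↭) (AllP.¬Any⇒All¬ _ x∉ ∷ u))
      (⊆-respˡ-↭ (↭-sym bs′↭) (∷⁺ʳ x ⊆ts)) (⊆-respʳ-↭ (↭-sym bs′↭) (∷⁺ʳ x ⊇ts))
      (AllPairsP.map⁻ (subst (AllPairs _<_) (sym (InsertedInto-blockMin bs<x i)) (AllPairsP.map⁺ sorted)))
      (trans (InsertedInto-weight bs<x i) w)
    where
    bs<x : All (_< x) (concat bs)
    bs<x = All.tabulate (All.lookup ts<x ∘ ⊆ts)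
    x∉ : x ∉ concat bs
    x∉ = x∉ts ∘ ⊆ts
    bs′↭ = InsertedInto-concat i

  remove-nonEmpty : ∀ bs′ → All (λ b → 0 < length b) bs′ → ¬ Any (LedBy x) bs′ →
    All (λ b → 0 < length b) (map (remove x) bs′)
  remove-nonEmpty []              _        _      = []
  remove-nonEmpty ((y ∷ v) ∷ bs′) (_ ∷ ne) notLed with x ≟ y
  ... | yes refl = ⊥-elim (notLed (here (led v)))
  ... | no  _    = s≤s z≤n ∷ remove-nonEmpty bs′ ne (notLed ∘ there)

  notLed-IsPartition : ∀ {m k bs′} → IsPartition (x ∷ ts) m k bs′ → ¬ Any (LedBy x) bs′ →
    IsPartition ts m k (map (remove x) bs′) × bs′ ∈ insertIntoBlocks x (map (remove x) bs′)
  notLed-IsPartition {m} {k} {bs′} (isPartition len ne u ⊆xts ⊇xts sorted w) notLed =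
    isPartition (trans (sym (InsertedInto-length i)) len) (remove-nonEmpty bs′ ne notLed) (AllPairs.tail u′)
      ⊆ts ⊇ts
      (AllPairsP.map⁻ (subst (AllPairs _<_) (InsertedInto-blockMin bs<x i) (AllPairsP.map⁺ sorted)))
      (trans (sym (InsertedInto-weight bs<x i)) w) ,
    bs′∈
    where
    bs = map (remove x) bs′
    bs′∈ : bs′ ∈ insertIntoBlocks x bs
    bs′∈ = ∈-insertIntoBlocks⁺ bs′ (⊇xts (here refl)) u notLed
    i = ∈-insertIntoBlocks⁻ bs bs′∈
    bs′↭ = InsertedInto-concat i
    u′ : Unique (x ∷ concat bs)
    u′ = Unique-resp-↭ bs′↭ u
    ⊆ts : concat bs ⊆ ts
    ⊆ts = ⊆∷∧∉⇒⊆ (⊆-trans (xs⊆x∷xs _ x) (⊆-respˡ-↭ bs′↭ ⊆xts)) (UniqueP.Unique[x∷xs]⇒x∉xs u′)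
    ⊇ts : ts ⊆ concat bs
    ⊇ts = ⊆∷∧∉⇒⊆ (⊆-trans (xs⊆x∷xs ts x) (⊆-respʳ-↭ bs′↭ ⊇xts)) x∉ts
    bs<x : All (_< x) (concat bs)
    bs<x = All.tabulate (All.lookup ts<x ∘ ⊆ts)

  insertByMin-IsPartition : ∀ {m k j w r} → j ≤ k → IsArrangement j ts w → IsPartition (ts ∖ w) m (k ∸ j) r →
    IsPartition (x ∷ ts) (suc m) k (insertByMin (x ∷ w) r)
  insertByMin-IsPartition {m} {k} {j} {w} {r} j≤k (len-w , u-w , w⊆ts) (isPartition len ne u ⊆ts∖w ⊇ts∖w sorted weight-r) =
    isPartition (trans (PermP.↭-length b↭) (cong suc len)) (PermP.All-resp-↭ (↭-sym b↭) (s≤s z≤n ∷ ne))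
      (Unique-resp-↭ (↭-sym c↭) (AllP.¬Any⇒All¬ _ (x∉ts ∘ w++r⊆ts) ∷ UniqueP.++⁺ u-w u (x∷w#r ∘ Product.map₁ there)))
      (⊆-respˡ-↭ (↭-sym c↭) (∷⁺ʳ x w++r⊆ts)) (⊆-respʳ-↭ (↭-sym c↭) (∷⁺ʳ x (⊆-++-∖ ⊇ts∖w)))
      (insertByMin-sorted (x ∷ w) r sorted (All.tabulate minsDiffer))
      (begin
        weight (insertByMin (x ∷ w) r)  ≡⟨ weight-insertByMin (x ∷ w) r ⟩
        blockWeight (x ∷ w) + weight r  ≡⟨ cong₂ _+_ (trans (blockWeight-led w (All.tabulate (All.lookup ts<x ∘ w⊆ts))) len-w) weight-r ⟩
        j + (k ∸ j)                     ≡⟨ m+[n∸m]≡n j≤k ⟩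
        k                               ∎)
    where
    open ≡-Reasoning
    b↭ = insertByMin-↭ (x ∷ w) r
    c↭ : concat (insertByMin (x ∷ w) r) ↭ x ∷ (w ++ concat r)
    c↭ = concat-↭ b↭
    w++r⊆ts : w ++ concat r ⊆ ts
    w++r⊆ts = ++-⊆-∖ w⊆ts ⊆ts∖w
    x∷w#r : Disjoint (x ∷ w) (concat r)
    x∷w#r (here refl , q) = x∉ts (w++r⊆ts (∈-++⁺ʳ w q))
    x∷w#r (there p , q)   = proj₂ (∈-filter⁻ (∉? w) {xs = ts} (⊆ts∖w q)) p
    minsDiffer : ∀ {c} → c ∈ r → blockMin (x ∷ w) ≢ blockMin c
    minsDiffer {c} c∈ e = x∷w#r (blockMin-∈ (x ∷ w) (s≤s z≤n) ,
      ∈-concat⁺′ (subst (_∈ c) (sym e) (blockMin-∈ c (All.lookup ne c∈))) c∈)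

  led-IsPartition : ∀ {m k w E} → IsPartition (x ∷ ts) (suc m) k (insertByMin (x ∷ w) E) → AllPairs _≺_ E →
    length w ≤ k × IsArrangement (length w) ts w × IsPartition (ts ∖ w) m (k ∸ length w) E
  led-IsPartition {m} {k} {w} {E} (isPartition len ne u ⊆xts ⊇xts sorted weight≡k) sortedE =
    length-w≤k , (refl , u-w , ⊆ts ∘ ∈-++⁺ˡ) ,
    isPartition (suc-injective (trans (sym (PermP.↭-length b↭)) len)) (All.tail (PermP.All-resp-↭ b↭ ne))
      u-E (⊆-∖ (⊆ts ∘ ∈-++⁺ʳ w) w#E) (∖-⊆ (⊆∷∧∉⇒⊆ (⊆-trans (xs⊆x∷xs ts x) (⊆-respʳ-↭ c↭ ⊇xts)) x∉ts))
      sortedE weight-E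
    where
    b↭ = insertByMin-↭ (x ∷ w) E
    c↭ : concat (insertByMin (x ∷ w) E) ↭ x ∷ (w ++ concat E)
    c↭ = concat-↭ b↭
    u′ : Unique (x ∷ (w ++ concat E))
    u′ = Unique-resp-↭ c↭ u
    u-w = proj₁ (Unique-++⁻ w (AllPairs.tail u′))
    u-E = proj₁ (proj₂ (Unique-++⁻ w (AllPairs.tail u′)))
    w#E = proj₂ (proj₂ (Unique-++⁻ w (AllPairs.tail u′)))
    ⊆ts : w ++ concat E ⊆ ts
    ⊆ts = ⊆∷∧∉⇒⊆ (⊆-trans (xs⊆x∷xs _ x) (⊆-respˡ-↭ c↭ ⊆xts)) (UniqueP.Unique[x∷xs]⇒x∉xs u′)
    w+E≡k : length w + weight E ≡ k
    w+E≡k = begin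
      length w + weight E             ≡⟨ cong (_+ weight E) (blockWeight-led w (All.tabulate (All.lookup ts<x ∘ ⊆ts ∘ ∈-++⁺ˡ))) ⟨
      blockWeight (x ∷ w) + weight E  ≡⟨ weight-insertByMin (x ∷ w) E ⟨
      weight (insertByMin (x ∷ w) E)  ≡⟨ weight≡k ⟩
      k                               ∎
      where open ≡-Reasoning
    length-w≤k : length w ≤ k
    length-w≤k = subst (length w ≤_) w+E≡k (m≤m+n (length w) (weight E))
    weight-E : weight E ≡ k ∸ length w
    weight-E = trans (sym (m+n∸m≡n (length w) (weight E))) (cong (_∸ length w) w+E≡k)

  insertedPartitions-Enumerates : ∀ {m k xs} → Enumerates xs (IsPartition ts m k) →
    Enumerates (concatMap (insertIntoBlocks x) xs) (λ bs → IsPartition (x ∷ ts) m k bs × ¬ Any (LedBy x) bs)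
  insertedPartitions-Enumerates {xs = xs} (u , xs⁻ , xs⁺) =
    Unique-concatMap⁺ (insertIntoBlocks x) (map (remove x)) u
      (λ {bs} bs∈ → Unique-insertIntoBlocks bs (x∉ bs∈))
      (λ {bs} bs∈ p → InsertedInto-remove (x∉ bs∈) (∈-insertIntoBlocks⁻ bs p)) ,
    sound , complete
    where
    x∉ : ∀ {bs} → bs ∈ xs → x ∉ concat bs
    x∉ bs∈ = x∉ts ∘ IsPartition.⊆T (xs⁻ bs∈)
    sound : ∀ {bs′} → bs′ ∈ concatMap (insertIntoBlocks x) xs → _
    sound q with find (∈-concatMap⁻ (insertIntoBlocks x) {xs = xs} q)
    ... | bs , bs∈ , p = InsertedInto-IsPartition (xs⁻ bs∈) i , InsertedInto-notLed (x∉ bs∈) i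
      where i = ∈-insertIntoBlocks⁻ bs p
    complete : ∀ {bs′} → _ → bs′ ∈ concatMap (insertIntoBlocks x) xs
    complete (P , notLed) with notLed-IsPartition P notLed
    ... | P′ , p = ∈-concatMap⁺ (insertIntoBlocks x) {xs = xs} (lose (xs⁺ P′) p)

  module _ (rec : List ℕ → ℕ → ℕ → List Blocks)
           (rec-ok : ∀ w m k → Enumerates (rec (ts ∖ w) m k) (IsPartition (ts ∖ w) m k)) where

    private
      rec-notLed : ∀ {w m k r} → r ∈ rec (ts ∖ w) m k → ¬ Any (LedBy x) r
      rec-notLed {w} {m} {k} {r} r∈ l =
        x∉ts (proj₁ (∈-filter⁻ (∉? w) (IsPartition.⊆T (proj₁ (proj₂ (rec-ok w m k)) r∈) (leader-∈ r l))))

    ∈-ledPartitionsOfSize⁻ : ∀ {m k j bs} → bs ∈ ledPartitionsOfSize rec x ts m k j →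
      j ≤ k × Σ (List ℕ) λ w → w ∈ arrangements j ts × Σ Blocks λ r → r ∈ rec (ts ∖ w) m (k ∸ j) ×
      bs ≡ insertByMin (x ∷ w) r
    ∈-ledPartitionsOfSize⁻ {m} {k} {j} p with j ≤? k | p
    ... | no  _   | ()
    ... | yes j≤k | p′ with find (∈-concatMap⁻ (λ w → map (insertByMin (x ∷ w)) (rec (ts ∖ w) m (k ∸ j))) {xs = arrangements j ts} p′)
    ...   | w , w∈ , q with ∈-map⁻ (insertByMin (x ∷ w)) q
    ...     | r , r∈ , eq = j≤k , w , w∈ , r , r∈ , eq

    ∈-ledPartitionsOfSize⁺ : ∀ {m k j w r} → j ≤ k → w ∈ arrangements j ts → r ∈ rec (ts ∖ w) m (k ∸ j) →
      insertByMin (x ∷ w) r ∈ ledPartitionsOfSize rec x ts m k j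
    ∈-ledPartitionsOfSize⁺ {m} {k} {j} {w} j≤k w∈ r∈ with j ≤? k
    ... | no  j≰k = ⊥-elim (j≰k j≤k)
    ... | yes _   = ∈-concatMap⁺ (λ w → map (insertByMin (x ∷ w)) (rec (ts ∖ w) m (k ∸ j))) {xs = arrangements j ts}
                      (lose w∈ (∈-map⁺ (insertByMin (x ∷ w)) r∈))

    -- A led partition determines its leading block x ∷ w, hence w and j = length w.
    Unique-ledPartitionsOfSize : ∀ m k j → Unique (ledPartitionsOfSize rec x ts m k j)
    Unique-ledPartitionsOfSize m k j with j ≤? k
    ... | no  _ = []
    ... | yes _ = Unique-concatMap⁺ (λ w → map (insertByMin (x ∷ w)) (rec (ts ∖ w) m (k ∸ j))) (tail ∘ blockLedBy x)
        (Unique-arrangements j ts u-ts)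
        (λ {w} _ → Unique-map⁺-retract (insertByMin (x ∷ w)) (deleteBlockLedBy x) (proj₁ (rec-ok w m (k ∸ j)))
          (λ r∈ → deleteBlockLedBy-insertByMin x w _ (rec-notLed r∈)))
        (λ {w} _ q → leader-tail w q)
      where
      tail : List ℕ → List ℕ
      tail []      = []
      tail (_ ∷ v) = v
      leader-tail : ∀ w {bs} → bs ∈ map (insertByMin (x ∷ w)) (rec (ts ∖ w) m (k ∸ j)) → tail (blockLedBy x bs) ≡ w
      leader-tail w q with ∈-map⁻ (insertByMin (x ∷ w)) q
      ... | r , r∈ , refl = cong tail (blockLedBy-insertByMin x w r (rec-notLed r∈))

    ledPartitionsOfSize-size : ∀ {m k j bs} → bs ∈ ledPartitionsOfSize rec x ts m k j → length (blockLedBy x bs) ∸ 1 ≡ j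
    ledPartitionsOfSize-size {m} {k} {j} p with ∈-ledPartitionsOfSize⁻ {m} {k} {j} p
    ... | _ , w , w∈ , r , r∈ , refl =
      trans (cong (λ b → length b ∸ 1) (blockLedBy-insertByMin x w r (rec-notLed r∈)))
            (proj₁ (∈-arrangements⁻ j ts u-ts w∈))

    Unique-ledPartitions : ∀ m k → Unique (ledPartitions rec x ts m k)
    Unique-ledPartitions zero    k = []
    Unique-ledPartitions (suc m) k =
      Unique-concatMap⁺ (ledPartitionsOfSize rec x ts m k) (λ bs → length (blockLedBy x bs) ∸ 1)
        (UniqueP.upTo⁺ (suc (length ts))) (λ {j} _ → Unique-ledPartitionsOfSize m k j) (λ _ → ledPartitionsOfSize-size)

    ∈-ledPartitions⁻ : ∀ m k {bs} → bs ∈ ledPartitions rec x ts m k → IsPartition (x ∷ ts) m k bs × Any (LedBy x) bs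
    ∈-ledPartitions⁻ (suc m) k p with find (∈-concatMap⁻ (ledPartitionsOfSize rec x ts m k) {xs = upTo (suc (length ts))} p)
    ... | j , _ , q with ∈-ledPartitionsOfSize⁻ q
    ...   | j≤k , w , w∈ , r , r∈ , refl =
      insertByMin-IsPartition j≤k (∈-arrangements⁻ j ts u-ts w∈) (proj₁ (proj₂ (rec-ok w m (k ∸ j))) r∈) ,
      PermP.Any-resp-↭ (↭-sym (insertByMin-↭ (x ∷ w) r)) (here (led w))

    ∈-ledPartitions⁺ : ∀ m k {bs} → IsPartition (x ∷ ts) m k bs → Any (LedBy x) bs → bs ∈ ledPartitions rec x ts m k
    ∈-ledPartitions⁺ zero    k {_ ∷ _} P _ = ⊥-elim (1+n≢0 (IsPartition.length≡ P))
    ∈-ledPartitions⁺ (suc m) k {bs}    P l =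
      subst (_∈ ledPartitions rec x ts (suc m) k) bs≡
        (∈-concatMap⁺ (ledPartitionsOfSize rec x ts m k) {xs = upTo (suc (length ts))}
          (lose (∈-upTo⁺ (s≤s (length-mono-⊆ _≟_ u-w w⊆ts)))
            (∈-ledPartitionsOfSize⁺ w≤k (∈-arrangements⁺ _ ts u-ts (refl , u-w , w⊆ts)) (proj₂ (proj₂ (rec-ok w m _)) P′))))
      where
      w = proj₁ (blockLedBy-led x bs l)
      bs≡ : insertByMin (x ∷ w) (deleteBlockLedBy x bs) ≡ bs
      bs≡ = trans (cong (λ b → insertByMin b (deleteBlockLedBy x bs)) (sym (proj₂ (blockLedBy-led x bs l))))
                  (insertByMin-blockLedBy x bs (IsPartition.sorted P) l)
      decomposed = led-IsPartition {w = w} (subst (IsPartition (x ∷ ts) (suc m) k) (sym bs≡) P)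
                                   (deleteBlockLedBy-sorted x bs (IsPartition.sorted P))
      w≤k = proj₁ decomposed
      u-w = proj₁ (proj₂ (proj₁ (proj₂ decomposed)))
      w⊆ts = proj₂ (proj₂ (proj₁ (proj₂ decomposed)))
      P′ = proj₂ (proj₂ decomposed)

    ledPartitions-Enumerates : ∀ m k →
      Enumerates (ledPartitions rec x ts m k) (λ bs → IsPartition (x ∷ ts) m k bs × Any (LedBy x) bs)
    ledPartitions-Enumerates m k =
      Unique-ledPartitions m k , ∈-ledPartitions⁻ m k , λ (P , l) → ∈-ledPartitions⁺ m k P l

partitions-Enumerates : ∀ f T → Descending T → length T ≤ f → ∀ m k →
  Enumerates (partitions f T m k) (IsPartition T m k)
partitions-Enumerates f       []       _    _         m k = partitions-[] f m k
partitions-Enumerates (suc f) (x ∷ ts) desc (s≤s len) m k =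
  Enumerates-++ (Any.any? (ledBy? x))
    (insertedPartitions-Enumerates desc (partitions-Enumerates f ts desc-ts len m k))
    (ledPartitions-Enumerates desc (partitions f) rec-ok m k)
  where
  desc-ts = AllPairs.tail desc
  rec-ok : ∀ w m k → Enumerates (partitions f (ts ∖ w) m k) (IsPartition (ts ∖ w) m k)
  rec-ok w = partitions-Enumerates f (ts ∖ w) (AllPairsP.filter⁺ (∉? w) desc-ts)
                                    (≤-trans (length-filter (∉? w) ts) len)

-- The recurrence

downTo1 : ℕ → List ℕ
downTo1 zero    = []
downTo1 (suc n) = suc n ∷ downTo1 n

length-downTo1 : ∀ n → length (downTo1 n) ≡ n
length-downTo1 zero    = refl
length-downTo1 (suc n) = cong suc (length-downTo1 n)

∈-downTo1⁻ : ∀ {n z} → z ∈ downTo1 n → 1 ≤ z × z ≤ n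
∈-downTo1⁻ {suc n} (here refl) = s≤s z≤n , ≤-refl
∈-downTo1⁻ {suc n} (there p)   = let 1≤z , z≤n′ = ∈-downTo1⁻ p in 1≤z , m≤n⇒m≤1+n z≤n′

∈-downTo1⁺ : ∀ {n z} → 1 ≤ z → z ≤ n → z ∈ downTo1 n
∈-downTo1⁺ {suc n} {suc z} 1≤z z≤n′ with suc z ≟ suc n
... | yes z≡n = here z≡n
... | no  z≢n = there (∈-downTo1⁺ 1≤z (≤-pred (≤∧≢⇒< z≤n′ z≢n)))

Descending-downTo1 : ∀ n → Descending (downTo1 n)
Descending-downTo1 zero    = []
Descending-downTo1 (suc n) = All.tabulate (s≤s ∘ proj₂ ∘ ∈-downTo1⁻) ∷ Descending-downTo1 n

count : ℕ → ℕ → ℕ → ℕ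
count n m k = length (partitions n (downTo1 n) m k)

leaderTerm : ℕ → ℕ → ℕ → ℕ → ℕ
leaderTerm n m k j with j ≤? k
... | yes _ = (n C j) * j ! * count (n ∸ j) m (k ∸ j)
... | no  _ = 0

leaderTerms : ℕ → ℕ → ℕ → ℕ
leaderTerms n zero    k = 0
leaderTerms n (suc m) k = sum (map (leaderTerm n m k) (upTo (suc n)))

length-∖ : ∀ {ts w j} → Unique ts → IsArrangement j ts w → length (ts ∖ w) ≡ length ts ∸ j
length-∖ {ts} {w} {j} u-ts (len-w , u-w , w⊆ts) = begin
  length (ts ∖ w)                                        ≡⟨ m+n∸m≡n (length ts∩w) _ ⟨
  length ts∩w + length (ts ∖ w) ∸ length ts∩w             ≡⟨ cong₂ _∸_ (length-filter-∁ (_∈? w) ts) ts∩w≡w ⟩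
  length ts ∸ j                                          ∎
  where
  open ≡-Reasoning
  ts∩w = filter (_∈? w) ts
  ts∩w≡w : length ts∩w ≡ j
  ts∩w≡w = trans (length-≡-⊆⊇ _≟_ (UniqueP.filter⁺ (_∈? w) u-ts) u-w
                    (λ q → proj₂ (∈-filter⁻ (_∈? w) {xs = ts} q)) (λ q → ∈-filter⁺ (_∈? w) (w⊆ts q) q))
                 len-w

module _ {x : ℕ} {ts : List ℕ} (u-ts : Unique ts) where

  length-insertedPartitions : ∀ {m k xs} → (∀ {bs} → bs ∈ xs → IsPartition ts m k bs) →
    length (concatMap (insertIntoBlocks x) xs) ≡ length xs * length ts
  length-insertedPartitions {xs = xs} xs⁻ =
    trans (length-concatMap (insertIntoBlocks x) xs)
      (sum-map-const (length ∘ insertIntoBlocks x) xs λ {bs} bs∈ →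
        let open IsPartition (xs⁻ bs∈) in
        trans (length-insertIntoBlocks bs) (length-≡-⊆⊇ _≟_ unique u-ts ⊆T ⊇T))

  module _ (rec : List ℕ → ℕ → ℕ → List Blocks)
           (rec-count : ∀ {j w} → IsArrangement j ts w → ∀ m k → length (rec (ts ∖ w) m k) ≡ count (length ts ∸ j) m k)
           where

    length-ledPartitionsOfSize : ∀ m k j → length (ledPartitionsOfSize rec x ts m k j) ≡ leaderTerm (length ts) m k j
    length-ledPartitionsOfSize m k j with j ≤? k
    ... | no  _ = refl
    ... | yes _ = begin
      length (concatMap ledBy-w (arrangements j ts))
        ≡⟨ length-concatMap ledBy-w (arrangements j ts) ⟩
      sum (map (length ∘ ledBy-w) (arrangements j ts))
        ≡⟨ sum-map-const (length ∘ ledBy-w) (arrangements j ts) (λ {w} w∈ →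
             trans (length-map (insertByMin (x ∷ w)) (rec (ts ∖ w) m (k ∸ j))) (rec-count (∈-arrangements⁻ j ts u-ts w∈) m (k ∸ j))) ⟩
      length (arrangements j ts) * count (length ts ∸ j) m (k ∸ j)
        ≡⟨ cong (_* count (length ts ∸ j) m (k ∸ j)) (length-arrangements j ts u-ts) ⟩
      (length ts C j) * j ! * count (length ts ∸ j) m (k ∸ j) ∎
      where
      open ≡-Reasoning
      ledBy-w : List ℕ → List Blocks
      ledBy-w w = map (insertByMin (x ∷ w)) (rec (ts ∖ w) m (k ∸ j))

    length-ledPartitions : ∀ m k → length (ledPartitions rec x ts m k) ≡ leaderTerms (length ts) m k
    length-ledPartitions zero    k = refl
    length-ledPartitions (suc m) k =
      trans (length-concatMap (ledPartitionsOfSize rec x ts m k) (upTo (suc (length ts))))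
            (sum-map-cong (upTo (suc (length ts))) (λ {j} _ → length-ledPartitionsOfSize m k j))

length-partitions-step : ∀ {f x ts} → Descending (x ∷ ts) → length ts ≤ f →
  (∀ T → Descending T → length T ≤ length ts → ∀ m k → length (partitions f T m k) ≡ count (length T) m k) →
  ∀ m k → length (partitions (suc f) (x ∷ ts) m k) ≡ count (length ts) m k * length ts + leaderTerms (length ts) m k
length-partitions-step {f} {x} {ts} desc len IH m k =
  trans (length-++ (concatMap (insertIntoBlocks x) (partitions f ts m k)))
    (cong₂ _+_ (trans (length-insertedPartitions u-ts (proj₁ (proj₂ (partitions-Enumerates f ts desc-ts len m k))))
                      (cong (_* length ts) (IH ts desc-ts ≤-refl m k)))
               (length-ledPartitions u-ts (partitions f) rec-count m k))
  where
  desc-ts = AllPairs.tail desc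
  u-ts = Descending⇒Unique desc-ts
  rec-count : ∀ {j w} → IsArrangement j ts w → ∀ m k → length (partitions f (ts ∖ w) m k) ≡ count (length ts ∸ j) m k
  rec-count {j} {w} arr m k =
    trans (IH (ts ∖ w) (AllPairsP.filter⁺ (∉? w) desc-ts) (length-filter (∉? w) ts) m k)
          (cong (λ n → count n m k) (length-∖ u-ts arr))

length-partitions-fuel : ∀ f f′ T → Descending T → length T ≤ f → length T ≤ f′ → ∀ m k →
  length (partitions f T m k) ≡ length (partitions f′ T m k)
length-partitions-fuel f f′ T desc len len′ m k =
  length-Enumerates (≡-dec (≡-dec _≟_)) (partitions-Enumerates f T desc len m k) (partitions-Enumerates f′ T desc len′ m k)

count-suc-from : ∀ n → (∀ T → Descending T → length T ≤ n → ∀ m k → length (partitions n T m k) ≡ count (length T) m k) →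
  ∀ m k → count (suc n) m k ≡ count n m k * n + leaderTerms n m k
count-suc-from n IH m k =
  trans (length-partitions-step (Descending-downTo1 (suc n)) (≤-reflexive (length-downTo1 n))
           (λ T desc len → IH T desc (≤-trans len (≤-reflexive (length-downTo1 n)))) m k)
        (cong (λ t → count t m k * t + leaderTerms t m k) (length-downTo1 n))

-- The count depends only on the length of the ground list: weights only compare elements.
length-partitions : ∀ f T → Descending T → length T ≤ f → ∀ m k → length (partitions f T m k) ≡ count (length T) m k
length-partitions f       []       _    _         m k = length-partitions-fuel f 0 [] [] z≤n z≤n m k
length-partitions (suc f) (x ∷ ts) desc (s≤s len) m k =
  trans (length-partitions-step desc len IH m k) (sym (count-suc-from (length ts) IH′ m k))
  where
  IH : ∀ T → Descending T → length T ≤ length ts → ∀ m k → length (partitions f T m k) ≡ count (length T) m k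
  IH T desc-T len-T = length-partitions f T desc-T (≤-trans len-T len)
  IH′ : ∀ T → Descending T → length T ≤ length ts → ∀ m k → length (partitions (length ts) T m k) ≡ count (length T) m k
  IH′ T desc-T len-T m k = trans (length-partitions-fuel _ f T desc-T len-T (≤-trans len-T len) m k) (IH T desc-T len-T m k)

count-suc : ∀ n m k → count (suc n) m k ≡ count n m k * n + leaderTerms n m k
count-suc n = count-suc-from n (λ T desc len → length-partitions n T desc len)

-- Linearly ordered partitions of {1,…,n}

words-suc : ∀ {A : Set} k (xs : List A) → words (suc k) xs ≡ cartesianProductWith _∷_ xs (words k xs)
words-suc k xs = go xs
  where
  go : ∀ ys → concatMap (λ y → map (y ∷_) (words k xs)) ys ≡ cartesianProductWith _∷_ ys (words k xs)
  go []       = refl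
  go (y ∷ ys) = cong (map (y ∷_) (words k xs) ++_) (go ys)

Unique-words : ∀ {A : Set} k {xs : List A} → Unique xs → Unique (words k xs)
Unique-words zero    _ = [] ∷ []
Unique-words (suc k) {xs} u rewrite words-suc k xs =
  UniqueP.cartesianProductWith⁺ _∷_ ∷-injective u (Unique-words k u)

∈-words⁺ : ∀ {A : Set} {xs : List A} {w} → All (_∈ xs) w → w ∈ words (length w) xs
∈-words⁺                     []          = here refl
∈-words⁺ {xs = xs} {a ∷ w} (a∈ ∷ w⊆) rewrite words-suc (length w) xs =
  ∈-cartesianProductWith⁺ _∷_ a∈ (∈-words⁺ w⊆)

length-∈-words : ∀ {A : Set} k {xs : List A} {w} → w ∈ words k xs → length w ≡ k
length-∈-words zero    (here refl) = refl
length-∈-words (suc k) {xs} p rewrite words-suc k xs with ∈-cartesianProductWith⁻ _∷_ xs (words k xs) p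
... | _ , v , _ , v∈ , refl = cong suc (length-∈-words k v∈)

Unique-oneTo : ∀ n → Unique (oneTo n)
Unique-oneTo n = UniqueP.map⁺ suc-injective (UniqueP.upTo⁺ n)

∈-oneTo⁻ : ∀ {n z} → z ∈ oneTo n → 1 ≤ z × z ≤ n
∈-oneTo⁻ q with ∈-map⁻ suc q
... | i , i∈ , refl = s≤s z≤n , ∈-upTo⁻ i∈

∈-oneTo⁺ : ∀ {n z} → 1 ≤ z → z ≤ n → z ∈ oneTo n
∈-oneTo⁺ {z = suc z} _ z<n = ∈-map⁺ suc (∈-upTo⁺ z<n)

Unique-candidates : ∀ n m → Unique (candidates n m)
Unique-candidates n m = Unique-words m (Unique-concatMap⁺ (λ k → words k (oneTo n)) length (UniqueP.upTo⁺ (suc n))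
  (λ {k} _ → Unique-words k (Unique-oneTo n)) (λ {k} _ → length-∈-words k))

∈-candidates : ∀ {n m k bs} → IsPartition (downTo1 n) m k bs → bs ∈ candidates n m
∈-candidates {n} {m} {k} {bs} P = subst (λ l → bs ∈ words l _) length≡ (∈-words⁺ (All.tabulate block∈))
  where
  open IsPartition P
  block∈ : ∀ {b} → b ∈ bs → b ∈ concatMap (λ l → words l (oneTo n)) (upTo (suc n))
  block∈ {b} b∈ = ∈-concatMap⁺ (λ l → words l (oneTo n)) {xs = upTo (suc n)}
    (lose (∈-upTo⁺ (s≤s length-b≤n)) (∈-words⁺ (All.tabulate (λ q → let 1≤z , z≤n′ = ∈-downTo1⁻ (b⊆ q) in ∈-oneTo⁺ 1≤z z≤n′))))
    where
    b⊆ : b ⊆ downTo1 n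
    b⊆ q = ⊆T (∈-concat⁺′ q b∈)
    length-b≤n : length b ≤ n
    length-b≤n = ≤-trans (length-mono-⊆ _≟_ (All.lookup (Unique-concat⁻ bs unique) b∈) b⊆) (≤-reflexive (length-downTo1 n))

IsLOPartition⇒IsPartition : ∀ {n m k bs} → IsLOPartition n m bs → weight bs ≡ k → IsPartition (downTo1 n) m k bs
IsLOPartition⇒IsPartition (len , ne , u , bounded , covers , linked) w =
  isPartition len ne u (λ q → let 1≤z , z≤n′ = All.lookup bounded q in ∈-downTo1⁺ 1≤z z≤n′)
    (λ q → let 1≤z , z≤n′ = ∈-downTo1⁻ q in All.lookup covers (∈-oneTo⁺ 1≤z z≤n′))
    (LinkedP.Linked⇒AllPairs <-trans linked) w

IsPartition⇒IsLOPartition : ∀ {n m k bs} → IsPartition (downTo1 n) m k bs → IsLOPartition n m bs × weight bs ≡ k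
IsPartition⇒IsLOPartition (isPartition len ne u ⊆T ⊇T sorted w) =
  (len , ne , u , All.tabulate (∈-downTo1⁻ ∘ ⊆T) ,
   All.tabulate (λ q → let 1≤z , z≤n′ = ∈-oneTo⁻ q in ⊇T (∈-downTo1⁺ 1≤z z≤n′)) , LinkedP.AllPairs⇒Linked sorted) ,
  w

Wℕ≡count : ∀ k n m → Wℕ k n m ≡ count n m k
Wℕ≡count k n m = length-Enumerates (≡-dec (≡-dec _≟_)) filtered
  (partitions-Enumerates n (downTo1 n) (Descending-downTo1 n) (≤-reflexive (length-downTo1 n)) m k)
  where
  D : Decidable (λ bs → IsLOPartition n m bs × weight bs ≡ k)
  D bs = isLOPartition? n m bs ×-dec (weight bs ≟ k)
  filtered : Enumerates (filter D (candidates n m)) (IsPartition (downTo1 n) m k)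
  filtered = UniqueP.filter⁺ D (Unique-candidates n m) ,
    (λ q → let lo , w = proj₂ (∈-filter⁻ D {xs = candidates n m} q) in IsLOPartition⇒IsPartition lo w) ,
    (λ P → ∈-filter⁺ D (∈-candidates P) (IsPartition⇒IsLOPartition P))

W-negative : ∀ a j n m → W (-[1+ a ] - + j) n m ≡ 0
W-negative a zero    n m = refl
W-negative a (suc j) n m = refl

W-neg-+ : ∀ t n m → 0 < t → W (- (+ t)) n m ≡ 0
W-neg-+ (suc t) n m _ = refl

leaderTerm≡ : ∀ n m k j → leaderTerm n m k j ≡ (n C j) * j ! * W (+ k - + j) (n ∸ j) m
leaderTerm≡ n m k j with j ≤? k
... | yes j≤k = cong ((n C j) * j ! *_) (sym (begin
  W (+ k - + j) (n ∸ j) m  ≡⟨ cong (λ ℓ → W ℓ (n ∸ j) m) (trans (m-n≡m⊖n k j) (⊖-≥ j≤k)) ⟩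
  Wℕ (k ∸ j) (n ∸ j) m     ≡⟨ Wℕ≡count (k ∸ j) (n ∸ j) m ⟩
  count (n ∸ j) m (k ∸ j)  ∎))
  where open ≡-Reasoning
... | no  j≰k = sym (trans (cong ((n C j) * j ! *_) W≡0) (*-zeroʳ ((n C j) * j !)))
  where
  k<j = ≰⇒> j≰k
  W≡0 : W (+ k - + j) (n ∸ j) m ≡ 0
  W≡0 = trans (cong (λ ℓ → W ℓ (n ∸ j) m) (trans (m-n≡m⊖n k j) (⊖-< k<j))) (W-neg-+ (j ∸ k) (n ∸ j) m (m<n⇒0<n∸m k<j))

mainTheorem5 : (ℓ : ℤ) (n m : ℕ) → 1 ≤ n → 1 ≤ m →
    W ℓ n m ≡ (n ∸ 1) * W ℓ (n ∸ 1) m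
      + sum (map (λ j → ((n ∸ 1) C j) * (j !) * W (ℓ - + j) (n ∸ 1 ∸ j) (m ∸ 1)) (upTo n))
mainTheorem5 ℓ        zero    m       ()  _
mainTheorem5 ℓ        (suc n) zero    _   ()
mainTheorem5 (+ k)    (suc n) (suc m) _   _  = begin
  Wℕ k (suc n) (suc m)                             ≡⟨ Wℕ≡count k (suc n) (suc m) ⟩
  count (suc n) (suc m) k                          ≡⟨ count-suc n (suc m) k ⟩
  count n (suc m) k * n + leaderTerms n (suc m) k  ≡⟨ cong₂ _+_ (trans (*-comm _ n) (cong (n *_) (sym (Wℕ≡count k n (suc m)))))
                                                                (sum-map-cong (upTo (suc n)) (λ {j} _ → leaderTerm≡ n m k j)) ⟩
  n * Wℕ k n (suc m) + sum (map (λ j → (n C j) * j ! * W (+ k - + j) (n ∸ j) m) (upTo (suc n))) ∎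
  where open ≡-Reasoning
mainTheorem5 -[1+ a ] (suc n) (suc m) _   _  = sym (begin
  n * 0 + sum (map (λ j → (n C j) * j ! * W (-[1+ a ] - + j) (n ∸ j) m) (upTo (suc n)))
    ≡⟨ cong₂ _+_ (*-zeroʳ n) (sum-map-const _ (upTo (suc n)) λ {j} _ →
         trans (cong ((n C j) * j ! *_) (W-negative a j (n ∸ j) m)) (*-zeroʳ ((n C j) * j !))) ⟩
  length (upTo (suc n)) * 0
    ≡⟨ *-zeroʳ (length (upTo (suc n))) ⟩
  0 ∎)
  where open ≡-Reasoning
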